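{- Let $F$ be a $\lambda$-term whose only free variable is $x$, let $A$ be a closed $\lambda$-term, let $\nu$ be a variable not occurring in $F$ or $A$, let $J$ be a constant with reduction rule $(J\ \nu\ u)\triangleright\lambda y_1\dots\lambda y_p.(u\ (J\ \nu\ y_1)\dots(J\ \nu\ y_p))$ for a fixed integer $p\ge1$, and let $A'=(J\ \nu\ A)$. Then $\nu$ is never applied in a reduct of $F[x:=A']$, i.e. no term $t'$ with $F[x:=A']\triangleright^* t'$ contains a subterm of the form $(\nu\ u)$.
   Context: Terms are $\lambda$-terms possibly containing the constant $J$; $\triangleright$ denotes $\beta$-reduction together with the reduction rule of $J$, and $\triangleright^*$ its reflexive–transitive closure. -}

module Defs where

open import Data.Nat using (ℕ; zero; suc)
open import Data.Fin using (Fin; zero; suc)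
open import Relation.Binary.PropositionalEquality using (_≡_)
open import Relation.Nullary using (¬_)
open import Relation.Binary.Construct.Closure.ReflexiveTransitive using (Star)

-- λ-terms with the constant J, in locally-nameless style:
-- bound variables are de Bruijn indices (var, scoped by Fin n),
-- free variables are names (free : ℕ → Term n).
data Term (n : ℕ) : Set where
  var  : Fin n → Term n
  free : ℕ → Term n
  J    : Term n
  app  : Term n → Term n → Term n
  lam  : Term (suc n) → Term n

ext : ∀ {m n} → (Fin m → Fin n) → Fin (suc m) → Fin (suc n)
ext ρ zero    = zero
ext ρ (suc i) = suc (ρ i)

rename : ∀ {m n} → (Fin m → Fin n) → Term m → Term n
rename ρ (var i)   = var (ρ i)
rename ρ (free a)  = free a
rename ρ J         = J
rename ρ (app t u) = app (rename ρ t) (rename ρ u)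
rename ρ (lam t)   = lam (rename (ext ρ) t)

wk : ∀ {n} → Term n → Term (suc n)
wk = rename suc

exts : ∀ {m n} → (Fin m → Term n) → Fin (suc m) → Term (suc n)
exts σ zero    = var zero
exts σ (suc i) = wk (σ i)

subst : ∀ {m n} → (Fin m → Term n) → Term m → Term n
subst σ (var i)   = σ i
subst σ (free a)  = free a
subst σ J         = J
subst σ (app t u) = app (subst σ t) (subst σ u)
subst σ (lam t)   = lam (subst (exts σ) t)

single : ∀ {n} → Term n → Fin (suc n) → Term n
single s zero    = s
single s (suc i) = var i

_[_] : ∀ {n} → Term (suc n) → Term n → Term n
t [ s ] = subst (single s) t

-- Right-hand side of the J rule:
-- Jrhs ν p u = λy₁ … λyₚ. (u (J ν y₁) … (J ν yₚ))
Jrhs : ∀ {n} → ℕ → ℕ → Term n → Term n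
Jrhs ν zero    t = t
Jrhs ν (suc k) t = lam (Jrhs ν k (app (wk t) (app (app J (free ν)) (var zero))))

data Step (p ν : ℕ) {n : ℕ} : Term n → Term n → Set where
  β     : ∀ {t : Term (suc n)} {s} → Step p ν (app (lam t) s) (t [ s ])
  Jrule : ∀ {u} → Step p ν (app (app J (free ν)) u) (Jrhs ν p u)
  appL  : ∀ {t t' u} → Step p ν t t' → Step p ν (app t u) (app t' u)
  appR  : ∀ {t u u'} → Step p ν u u' → Step p ν (app t u) (app t u')
  lamC  : ∀ {t t' : Term (suc n)} → Step p ν t t' → Step p ν (lam t) (lam t')

Steps : (p ν : ℕ) {n : ℕ} → Term n → Term n → Set
Steps p ν = Star (Step p ν)

data Occurs (a : ℕ) {n : ℕ} : Term n → Set where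
  here : Occurs a (free a)
  appL : ∀ {t u} → Occurs a t → Occurs a (app t u)
  appR : ∀ {t u} → Occurs a u → Occurs a (app t u)
  lamC : ∀ {t} → Occurs a t → Occurs a (lam t)

-- t has no free names (its only free variables are its de Bruijn scope)
NoFreeNames : ∀ {n} → Term n → Set
NoFreeNames t = ∀ a → ¬ Occurs a t

data NuApplied (ν : ℕ) {n : ℕ} : Term n → Set where
  here : ∀ {u} → NuApplied ν (app (free ν) u)
  appL : ∀ {t u} → NuApplied ν t → NuApplied ν (app t u)
  appR : ∀ {t u} → NuApplied ν u → NuApplied ν (app t u)
  lamC : ∀ {t} → NuApplied ν t → NuApplied ν (lam t)

-- Call a term ν-guarded when every occurrence of the name ν
-- sits in the head position (J ν), i.e. ν occurs only as the first argument
-- of J.  A ν-guarded term cannot contain a subterm (ν u), since there ν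
-- would stand alone in function position.  The whole proof is the remark
-- that ν-guardedness is an invariant of reduction:
--   * it is preserved by renaming and by substituting ν-guarded terms,
--     hence by β-reduction;
--   * the right-hand side λy₁…λyₚ.(u (J ν y₁) … (J ν yₚ)) of the J rule
--     only introduces ν inside J ν, so the J rule preserves it too;
--   * it is closed under term contexts, hence preserved by ▷*.
-- Since F and A do not mention ν, F[x := J ν A] is ν-guarded, and so is
-- every reduct of it, which therefore never applies ν.
module Submission where

open import Defs
open import Data.Nat using (ℕ; zero; suc; _≤_)
open import Data.Fin using (Fin; zero; suc)
open import Data.Empty using (⊥-elim)
open import Relation.Nullary using (¬_)
open import Relation.Binary.PropositionalEquality using (_≡_; refl)
open import Relation.Binary.Construct.Closure.ReflexiveTransitive using (ε; _◅_)

data Guarded (ν : ℕ) {n : ℕ} : Term n → Set where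
  var   : ∀ {i} → Guarded ν (var i)
  free  : ∀ {a} → ¬ a ≡ ν → Guarded ν (free a)
  J     : Guarded ν J
  Jν    : Guarded ν (app J (free ν))
  app   : ∀ {t u} → Guarded ν t → Guarded ν u → Guarded ν (app t u)
  lam   : ∀ {t} → Guarded ν t → Guarded ν (lam t)

-- The bare name ν is not guarded; this is what rules out both (ν u)
-- and a J rule instance whose J is applied to something other than J ν.
unguarded-ν : ∀ {ν n} → ¬ Guarded ν {n} (free ν)
unguarded-ν (free ν≢ν) = ν≢ν refl

fresh⇒guarded : ∀ {ν n} (t : Term n) → ¬ Occurs ν t → Guarded ν t
fresh⇒guarded (var i)   _      = var
fresh⇒guarded (free a)  ν∉a    = free λ { refl → ν∉a here }
fresh⇒guarded J         _      = J
fresh⇒guarded (app t u) ν∉tu   =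
  app (fresh⇒guarded t λ o → ν∉tu (appL o)) (fresh⇒guarded u λ o → ν∉tu (appR o))
fresh⇒guarded (lam t)   ν∉λt   = lam (fresh⇒guarded t λ o → ν∉λt (lamC o))

rename-guarded : ∀ {ν m n} (ρ : Fin m → Fin n) {t : Term m}
               → Guarded ν t → Guarded ν (rename ρ t)
rename-guarded ρ var        = var
rename-guarded ρ (free a≢ν) = free a≢ν
rename-guarded ρ J          = J
rename-guarded ρ Jν         = Jν
rename-guarded ρ (app g h)  = app (rename-guarded ρ g) (rename-guarded ρ h)
rename-guarded ρ (lam g)    = lam (rename-guarded (ext ρ) g)

GuardedSubst : ∀ {m n} → ℕ → (Fin m → Term n) → Set
GuardedSubst ν σ = ∀ i → Guarded ν (σ i)

exts-guarded : ∀ {ν m n} {σ : Fin m → Term n}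
             → GuardedSubst ν σ → GuardedSubst ν (exts σ)
exts-guarded gσ zero    = var
exts-guarded gσ (suc i) = rename-guarded suc (gσ i)

subst-guarded : ∀ {ν m n} {σ : Fin m → Term n} → GuardedSubst ν σ
              → {t : Term m} → Guarded ν t → Guarded ν (subst σ t)
subst-guarded gσ (var {i})  = gσ i
subst-guarded gσ (free a≢ν) = free a≢ν
subst-guarded gσ J          = J
subst-guarded gσ Jν         = Jν
subst-guarded gσ (app g h)  = app (subst-guarded gσ g) (subst-guarded gσ h)
subst-guarded gσ (lam g)    = lam (subst-guarded (exts-guarded gσ) g)

instantiate-guarded : ∀ {ν n} {t : Term (suc n)} {s : Term n}
                    → Guarded ν t → Guarded ν s → Guarded ν (t [ s ])
instantiate-guarded {ν} {s = s} gt gs = subst-guarded single-guarded gt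
  where
  single-guarded : GuardedSubst ν (single s)
  single-guarded zero    = gs
  single-guarded (suc i) = var

Jrhs-guarded : ∀ {ν n} k {u : Term n} → Guarded ν u → Guarded ν (Jrhs ν k u)
Jrhs-guarded zero    gu = gu
Jrhs-guarded (suc k) gu = lam (Jrhs-guarded k (app (rename-guarded suc gu) (app Jν var)))

step-guarded : ∀ {p ν n} {t t' : Term n} → Step p ν t t' → Guarded ν t → Guarded ν t'
step-guarded β              (app (lam gt) gs)   = instantiate-guarded gt gs
step-guarded {p} Jrule      (app Jν gu)         = Jrhs-guarded p gu
step-guarded Jrule          (app (app J gν) _)  = ⊥-elim (unguarded-ν gν)
step-guarded (appL ())      Jν
step-guarded (appL s)       (app gt gu)         = app (step-guarded s gt) gu
step-guarded (appR ())      Jν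
step-guarded (appR s)       (app gt gu)         = app gt (step-guarded s gu)
step-guarded (lamC s)       (lam gt)            = lam (step-guarded s gt)

steps-guarded : ∀ {p ν n} {t t' : Term n} → Steps p ν t t' → Guarded ν t → Guarded ν t'
steps-guarded ε        gt = gt
steps-guarded (s ◅ ss) gt = steps-guarded ss (step-guarded s gt)

guarded⇒not-applied : ∀ {ν n} {t : Term n} → Guarded ν t → ¬ NuApplied ν t
guarded⇒not-applied (app gν _)  here     = unguarded-ν gν
guarded⇒not-applied Jν          (appL ())
guarded⇒not-applied (app gt _)  (appL a) = guarded⇒not-applied gt a
guarded⇒not-applied Jν          (appR ())
guarded⇒not-applied (app _ gu)  (appR a) = guarded⇒not-applied gu a
guarded⇒not-applied (lam gt)    (lamC a) = guarded⇒not-applied gt a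

lemma3p9 : (p : ℕ) → 1 ≤ p → (ν : ℕ)
         → (F : Term 1) → NoFreeNames F
         → (A : Term 0) → NoFreeNames A
         → ¬ Occurs ν F → ¬ Occurs ν A
         → ∀ (t' : Term 0)
         → Steps p ν (F [ app (app J (free ν)) A ]) t'
         → ¬ NuApplied ν t'
lemma3p9 p _ ν F _ A _ ν∉F ν∉A t' F[A']▷*t' =
  guarded⇒not-applied (steps-guarded F[A']▷*t' F[A']-guarded)
  where
  A'-guarded : Guarded ν (app (app J (free ν)) A)
  A'-guarded = app Jν (fresh⇒guarded A ν∉A)

  F[A']-guarded : Guarded ν (F [ app (app J (free ν)) A ])
  F[A']-guarded = instantiate-guarded (fresh⇒guarded F ν∉F) A'-guarded
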